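{- Let $n\ge2$, $k\ge0$, and let $Lie_{n,k}(X)$ be the subspace of the free Filippov $n$-algebra on a set $X$ spanned by $n$-bracketed words with $k$ brackets. Then the $n$-combs in $Lie_{n,k}(X)$ span $Lie_{n,k}(X)$.
   Context: For $n\ge 2$, a Filippov $n$-algebra is a complex vector space $L$ with an $n$-linear map $[\cdot,\dots,\cdot]:L^n\to L$ satisfying $[x_1,\dots,x_n]=\mathrm{sgn}(\sigma)[x_{\sigma(1)},\dots,x_{\sigma(n)}]$ for all $\sigma\in\mathfrak S_n$, and $[[x_1,\dots,x_n],x_{n+1},\dots,x_{2n-1}]=\sum_{i=1}^n[x_1,\dots,x_{i-1},[x_i,x_{n+1},\dots,x_{2n-1}],x_{i+1},\dots,x_n]$. The free Filippov $n$-algebra on $X$ is generated by all $n$-ary bracketings of elements of $X$, subject only to relations following from $n$-linearity, antisymmetry and the generalized Jacobi identity. An $n$-comb is an $n$-bracketed word of the form $[[\cdots[[a_0,a_{1,1},\dots,a_{1,n-1}],a_{2,1},\dots,a_{2,n-1}],\dots],a_{k,1},\dots,a_{k,n-1}]$ with all $a_0,a_{i,j}\in X$. -}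

module Defs where

open import Level using (Level; _⊔_; suc)
open import Data.Nat using (ℕ; zero)
import Data.Nat as ℕ
open import Data.Fin using (Fin; _≟_)
open import Data.Vec using (Vec; []; _∷_; lookup; _[_]≔_; tabulate; foldr; map; allFin)
open import Data.List using (List)
import Data.List as List
open import Data.Product using (Σ; _×_; _,_; ∃; proj₁; proj₂)
open import Data.List.Relation.Unary.All using (All)
open import Data.Empty using (⊥)
open import Relation.Nullary using (¬_)
open import Relation.Binary.PropositionalEquality using (_≡_)
open import Algebra.Bundles using (CommutativeRing)

record Field (c ℓ : Level) : Set (Level.suc (c ⊔ ℓ)) where
  field
    commutativeRing : CommutativeRing c ℓ
  open CommutativeRing commutativeRing public
  field
    0≉1     : ¬ (0# ≈ 1#)
    inverse : ∀ x → ¬ (x ≈ 0#) → Σ Carrier (λ y → (x * y) ≈ 1#)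

swapV : ∀ {a} {A : Set a} {n} → Fin n → Fin n → Vec A n → Vec A n
swapV i j v = (v [ i ]≔ lookup v j) [ j ]≔ lookup v i

-- The free Filippov (suc m)-algebra over a field F on a set X.
-- Arity n = suc m; the paper's hypothesis n ≥ 2 is 1 ≤ m.

module FreeFilippov {c ℓ : Level} (F : Field c ℓ) (X : Set c) (m : ℕ) where
  open Field F using (_≈_; _+_; _*_; -_; 0#; 1#) renaming (Carrier to K)

  n : ℕ
  n = Data.Nat.suc m

  data Tm : Set c where
    gen  : X → Tm
    br   : Vec Tm n → Tm
    0t   : Tm
    _+t_ : Tm → Tm → Tm
    _·t_ : K → Tm → Tm

  infixl 6 _+t_
  infixr 7 _·t_

  sumT : ∀ {k} → Vec Tm k → Tm
  sumT = foldr _ _+t_ 0t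

  -- Tm quotiented by _≈t_ is the free Filippov algebra.
  infix 4 _≈t_
  data _≈t_ : Tm → Tm → Set (c ⊔ ℓ) where
    reflt  : ∀ {x} → x ≈t x
    symt   : ∀ {x y} → x ≈t y → y ≈t x
    transt : ∀ {x y z} → x ≈t y → y ≈t z → x ≈t z
    t+-cong : ∀ {x x′ y y′} → x ≈t x′ → y ≈t y′ → x +t y ≈t x′ +t y′
    t·-cong : ∀ {a b x y} → a ≈ b → x ≈t y → a ·t x ≈t b ·t y
    br-cong : ∀ (v : Vec Tm n) (i : Fin n) {x y} → x ≈t y →
              br (v [ i ]≔ x) ≈t br (v [ i ]≔ y)
    t+-assoc : ∀ x y z → (x +t y) +t z ≈t x +t (y +t z)
    t+-comm  : ∀ x y → x +t y ≈t y +t x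
    t+-idˡ   : ∀ x → 0t +t x ≈t x
    t+-invˡ  : ∀ x → (- 1#) ·t x +t x ≈t 0t
    t·-distribˡ : ∀ a x y → a ·t (x +t y) ≈t a ·t x +t a ·t y
    t·-distribʳ : ∀ a b x → (a + b) ·t x ≈t a ·t x +t b ·t x
    t·-assoc : ∀ a b x → (a * b) ·t x ≈t a ·t (b ·t x)
    t·-idˡ   : ∀ x → 1# ·t x ≈t x
    br-+ : ∀ (v : Vec Tm n) (i : Fin n) x y →
           br (v [ i ]≔ (x +t y)) ≈t br (v [ i ]≔ x) +t br (v [ i ]≔ y)
    br-· : ∀ (v : Vec Tm n) (i : Fin n) a x →
           br (v [ i ]≔ (a ·t x)) ≈t a ·t br (v [ i ]≔ x)
    -- antisymmetry (transpositions generate 𝔖ₙ, sgn of a transposition is -1)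
    br-antisym : ∀ (v : Vec Tm n) (i j : Fin n) → ¬ (i ≡ j) →
                 br (swapV i j v) ≈t (- 1#) ·t br v
    br-jacobi : ∀ (u : Vec Tm n) (ys : Vec Tm m) →
                br (br u ∷ ys) ≈t
                sumT (tabulate (λ i → br (u [ i ]≔ br (lookup u i ∷ ys))))

  data Word : Set c where
    leaf : X → Word
    node : Vec Word n → Word

  mutual
    brackets : Word → ℕ
    brackets (leaf x)  = 0
    brackets (node ws) = Data.Nat.suc (bracketsV ws)

    bracketsV : ∀ {k} → Vec Word k → ℕ
    bracketsV []       = 0
    bracketsV (w ∷ ws) = brackets w ℕ.+ bracketsV ws

  mutual
    ⟦_⟧ : Word → Tm
    ⟦ leaf x ⟧  = gen x
    ⟦ node ws ⟧ = br (⟦_⟧V ws)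

    ⟦_⟧V : ∀ {k} → Vec Word k → Vec Tm k
    ⟦ [] ⟧V     = []
    ⟦ w ∷ ws ⟧V = ⟦ w ⟧ ∷ ⟦ ws ⟧V

  data IsComb : Word → Set c where
    comb-leaf : ∀ x → IsComb (leaf x)
    comb-node : ∀ {w} (as : Vec X m) → IsComb w →
                IsComb (node (w ∷ map leaf as))

  InSpan : ∀ {p} → (Word → Set p) → Tm → Set (c ⊔ ℓ ⊔ p)
  InSpan P t = Σ (List (K × Word)) λ cs →
    All (λ aw → P (proj₂ aw)) cs ×
    t ≈t List.foldr (λ aw s → proj₁ aw ·t ⟦ proj₂ aw ⟧ +t s) 0t cs

  InLie : ℕ → Tm → Set (c ⊔ ℓ)
  InLie k = InSpan (λ w → brackets w ≡ k)

  InCombSpan : ℕ → Tm → Set (c ⊔ ℓ)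
  InCombSpan k = InSpan (λ w → IsComb w × brackets w ≡ k)

{-# OPTIONS --safe #-}
module Submission where

-- By multilinearity every word [w₁,…,wₙ] is a combination of brackets [c₁,…,cₙ] of combs
-- with the same total number K of brackets, and these lie in the span of combs by strong
-- induction on K. If some cᵢ = [e,b₁,…,bₘ] is not a letter, antisymmetry moves it to the
-- front (if all cᵢ are letters the bracket is itself a comb), and the Jacobi identity gives
--   [[e,b],z] = [[e,z],b] + Σⱼ [e,b₁,…,[bⱼ,z],…,bₘ].
-- By induction [e,z] and every [bⱼ,z] are combinations of combs, so what remains are brackets
-- [e,b₁,…,f,…,bₘ] of two combs e, f and letters. These yield to an inner induction on e:
-- a letter e is swapped with f, giving the comb [f,b₁,…,e,…,bₘ]; otherwise apply Jacobi again.

open import Defs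
open import Level using (Level; _⊔_)
open import Data.Nat using (ℕ; zero; suc; _+_; _<_; _≤_; s≤s)
open import Data.Nat.Properties using (≤-refl; m≤n+m; +-suc; +-identityʳ)
open import Data.Nat.Induction using (<-rec)
open import Induction.WellFounded using (WfRec)
open import Data.Fin using (Fin; zero; suc)
open import Data.Vec using (Vec; []; _∷_; lookup; _[_]≔_; tabulate; map)
open import Data.Vec.Properties using (lookup-map; map-[]≔; lookup∘update; []≔-idempotent)
open import Data.List using (List; []; _∷_; _++_)
import Data.List as List
open import Data.List.Relation.Unary.All using (All; []; _∷_)
open import Data.List.Relation.Unary.All.Properties using (++⁺; map⁺)
open import Data.Product using (_×_; _,_; proj₁; proj₂)
open import Relation.Binary.Bundles using (Setoid)
open import Relation.Binary.PropositionalEquality as ≡ using (_≡_; refl; cong; cong₂; subst)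
import Algebra.Properties.Ring as RingProperties

module CombSpanning {c ℓ : Level} (F : Field c ℓ) (X : Set c) (m : ℕ) where
  module F = Field F
  open F using (_*_; -_; 0#; 1#)
  open FreeFilippov F X m

  Tm-setoid : Setoid c (c ⊔ ℓ)
  Tm-setoid = record
    { Carrier       = Tm
    ; _≈_           = _≈t_
    ; isEquivalence = record { refl = reflt ; sym = symt ; trans = transt }
    }

  open import Relation.Binary.Reasoning.Setoid Tm-setoid

  0·x≈0 : ∀ x → 0# ·t x ≈t 0t
  0·x≈0 x = symt (begin
    0t                          ≈⟨ symt (t+-invˡ y) ⟩
    (- 1#) ·t y +t y            ≈⟨ t+-cong reflt y≈y+y ⟩
    (- 1#) ·t y +t (y +t y)     ≈⟨ symt (t+-assoc _ _ _) ⟩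
    ((- 1#) ·t y +t y) +t y     ≈⟨ t+-cong (t+-invˡ y) reflt ⟩
    0t +t y                     ≈⟨ t+-idˡ y ⟩
    y                           ∎)
    where
    y : Tm
    y = 0# ·t x
    y≈y+y : y ≈t y +t y
    y≈y+y = transt (t·-cong (F.sym (F.+-identityˡ 0#)) reflt) (t·-distribʳ 0# 0# x)

  a·0≈0 : ∀ a → a ·t 0t ≈t 0t
  a·0≈0 a = begin
    a ·t 0t            ≈⟨ t·-cong F.refl (symt (0·x≈0 0t)) ⟩
    a ·t (0# ·t 0t)    ≈⟨ symt (t·-assoc a 0# 0t) ⟩
    (a * 0#) ·t 0t     ≈⟨ t·-cong (F.zeroʳ a) reflt ⟩
    0# ·t 0t           ≈⟨ 0·x≈0 0t ⟩
    0t                 ∎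

  -1·-1·x≈x : ∀ x → (- 1#) ·t ((- 1#) ·t x) ≈t x
  -1·-1·x≈x x = begin
    (- 1#) ·t ((- 1#) ·t x)   ≈⟨ symt (t·-assoc (- 1#) (- 1#) x) ⟩
    ((- 1#) * (- 1#)) ·t x    ≈⟨ t·-cong -1*-1≈1 reflt ⟩
    1# ·t x                   ≈⟨ t·-idˡ x ⟩
    x                         ∎
    where
    open RingProperties F.ring using (-1*x≈-x; -‿involutive)
    -1*-1≈1 : (- 1#) * (- 1#) F.≈ 1#
    -1*-1≈1 = F.trans (-1*x≈-x (- 1#)) (-‿involutive 1#)

  record Linear (g : Tm → Tm) : Set (c ⊔ ℓ) where
    field
      ≈-cong : ∀ {x y} → x ≈t y → g x ≈t g y
      +-homo : ∀ x y → g (x +t y) ≈t g x +t g y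
      ·-homo : ∀ a x → g (a ·t x) ≈t a ·t g x

    0-homo : g 0t ≈t 0t
    0-homo = begin
      g 0t            ≈⟨ ≈-cong (symt (0·x≈0 0t)) ⟩
      g (0# ·t 0t)    ≈⟨ ·-homo 0# 0t ⟩
      0# ·t g 0t      ≈⟨ 0·x≈0 (g 0t) ⟩
      0t              ∎

  Multilinear : ∀ {l} → (Vec Tm l → Tm) → Set (c ⊔ ℓ)
  Multilinear f = ∀ v i → Linear (λ t → f (v [ i ]≔ t))

  br-multilinear : Multilinear br
  br-multilinear v i = record { ≈-cong = br-cong v i ; +-homo = br-+ v i ; ·-homo = br-· v i }

  data Span {I : Set c} (f : I → Tm) : Tm → Set (c ⊔ ℓ) where
    span-gen : ∀ i → Span f (f i)
    span-0   : Span f 0t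
    span-+   : ∀ {s t} → Span f s → Span f t → Span f (s +t t)
    span-·   : ∀ {t} a → Span f t → Span f (a ·t t)
    span-≈   : ∀ {s t} → s ≈t t → Span f t → Span f s

  module _ {I J : Set c} {f : I → Tm} {f′ : J → Tm} where

    Span-map : ∀ {g t} → Linear g → (∀ i → Span f′ (g (f i))) → Span f t → Span f′ (g t)
    Span-map L g-gen (span-gen i) = g-gen i
    Span-map L g-gen span-0       = span-≈ (Linear.0-homo L) span-0
    Span-map L g-gen (span-+ p q) =
      span-≈ (Linear.+-homo L _ _) (span-+ (Span-map L g-gen p) (Span-map L g-gen q))
    Span-map L g-gen (span-· a p) = span-≈ (Linear.·-homo L a _) (span-· a (Span-map L g-gen p))
    Span-map L g-gen (span-≈ e p) = span-≈ (Linear.≈-cong L e) (Span-map L g-gen p)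

  module _ {I : Set c} {f : I → Tm} where

    Span-sumT : ∀ {l} (h : Fin l → Tm) → (∀ j → Span f (h j)) → Span f (sumT (tabulate h))
    Span-sumT {zero}  h h∈ = span-0
    Span-sumT {suc l} h h∈ = span-+ (h∈ zero) (Span-sumT (λ j → h (suc j)) (λ j → h∈ (suc j)))

    Span-swap-head : ∀ x (v : Vec Tm m) j →
      Span f (br (lookup v j ∷ (v [ j ]≔ x))) → Span f (br (x ∷ v))
    Span-swap-head x v j p = span-≈ br≈-swap (span-· (- 1#) p)
      where
      br≈-swap : br (x ∷ v) ≈t (- 1#) ·t br (lookup v j ∷ (v [ j ]≔ x))
      br≈-swap = begin
        br (x ∷ v)                                  ≈⟨ symt (-1·-1·x≈x _) ⟩
        (- 1#) ·t ((- 1#) ·t br (x ∷ v))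
          ≈⟨ t·-cong F.refl (symt (br-antisym (x ∷ v) zero (suc j) λ ())) ⟩
        (- 1#) ·t br (lookup v j ∷ (v [ j ]≔ x))    ∎

  data Comb : ℕ → Set c where
    letter : X → Comb 0
    _◂_    : ∀ {k} → Comb k → Vec X m → Comb (suc k)

  ⟦_⟧ᶜ : ∀ {k} → Comb k → Tm
  ⟦ letter x ⟧ᶜ = gen x
  ⟦ c ◂ as ⟧ᶜ   = br (⟦ c ⟧ᶜ ∷ map gen as)

  CombSpan : ℕ → Tm → Set (c ⊔ ℓ)
  CombSpan k = Span (⟦_⟧ᶜ {k})

  data Combs : ∀ {l} → ℕ → Vec Tm l → Set c where
    []  : Combs 0 []
    _∷_ : ∀ {k K l} {ts : Vec Tm l} (c : Comb k) → Combs K ts → Combs (k + K) (⟦ c ⟧ᶜ ∷ ts)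

  letters-Combs : ∀ {l} (xs : Vec X l) → Combs 0 (map gen xs)
  letters-Combs []       = []
  letters-Combs (x ∷ xs) = letter x ∷ letters-Combs xs

  letters-with-comb-Combs : ∀ {l p} (bs : Vec X l) j (g : Comb p) →
    Combs p (map gen bs [ j ]≔ ⟦ g ⟧ᶜ)
  letters-with-comb-Combs {p = p} (b ∷ bs) zero g =
    subst (λ K → Combs K (⟦ g ⟧ᶜ ∷ map gen bs)) (+-identityʳ p) (g ∷ letters-Combs bs)
  letters-with-comb-Combs (b ∷ bs) (suc j) g = letter b ∷ letters-with-comb-Combs bs j g

  -- x is the letter that swapping the bracketed entry to the front moves into position j.
  data LettersOrBracket (x : X) {l} : ℕ → Vec Tm l → Set c where
    letters   : (xs : Vec X l) → LettersOrBracket x 0 (map gen xs)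
    bracketed : ∀ {a K zs} j (e : Comb a) (bs : Vec X m) → lookup zs j ≡ ⟦ e ◂ bs ⟧ᶜ →
                Combs K (zs [ j ]≔ gen x) → LettersOrBracket x (suc a + K) zs

  lettersOrBracket : ∀ {l K} {zs : Vec Tm l} x → Combs K zs → LettersOrBracket x K zs
  lettersOrBracket x [] = letters []
  lettersOrBracket x (letter y ∷ cs) with lettersOrBracket x cs
  ... | letters ys                  = letters (y ∷ ys)
  ... | bracketed j e bs zⱼ≡e◂bs cs′ = bracketed (suc j) e bs zⱼ≡e◂bs (letter y ∷ cs′)
  lettersOrBracket x ((e ◂ bs) ∷ cs) = bracketed zero e bs refl (letter x ∷ cs)

  BracketOfCombsSpanned : ℕ → Set (c ⊔ ℓ)
  BracketOfCombsSpanned K = ∀ {ts : Vec Tm n} → Combs K ts → CombSpan (suc K) (br ts)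

  ◂-CombSpan : ∀ {k t} (bs : Vec X m) → CombSpan k t → CombSpan (suc k) (br (t ∷ map gen bs))
  ◂-CombSpan {t = t} bs =
    Span-map (br-multilinear (t ∷ map gen bs) zero) (λ c → span-gen (c ◂ bs))

  jacobi-step : ∀ {a K} {zs : Vec Tm m} → WfRec _<_ BracketOfCombsSpanned (suc a + K) →
    (e : Comb a) (bs : Vec X m) → Combs K zs →
    (∀ (f : Comb (suc K)) j →
       CombSpan (suc (suc a + K)) (br (⟦ e ⟧ᶜ ∷ (map gen bs [ j ]≔ ⟦ f ⟧ᶜ)))) →
    CombSpan (suc (suc a + K)) (br (⟦ e ◂ bs ⟧ᶜ ∷ zs))
  jacobi-step {a} {K} {zs} rec e bs cs inner =
    span-≈ (br-jacobi u zs) (Span-sumT (λ i → br (u [ i ]≔ br (lookup u i ∷ zs))) summand)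
    where
    u : Vec Tm n
    u = ⟦ e ⟧ᶜ ∷ map gen bs
    summand : ∀ i → CombSpan (suc (suc a + K)) (br (u [ i ]≔ br (lookup u i ∷ zs)))
    summand zero = ◂-CombSpan bs (rec ≤-refl (e ∷ cs))
    summand (suc j) rewrite lookup-map j gen bs =
      Span-map (br-multilinear u (suc j)) (λ f → inner f j)
        (rec (s≤s (m≤n+m K a)) (letter (lookup bs j) ∷ cs))

  bracket-of-two-combs : ∀ {K q p} → WfRec _<_ BracketOfCombsSpanned K →
    (h : Comb q) (g : Comb p) → q + p ≡ K → (bs : Vec X m) (j : Fin m) →
    CombSpan (suc K) (br (⟦ h ⟧ᶜ ∷ (map gen bs [ j ]≔ ⟦ g ⟧ᶜ)))
  bracket-of-two-combs {p = p} rec (letter x) g refl bs j =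
    Span-swap-head (gen x) (map gen bs [ j ]≔ ⟦ g ⟧ᶜ) j
      (subst (λ v → CombSpan (suc p) (br v)) (≡.sym exchanged) (span-gen (g ◂ (bs [ j ]≔ x))))
    where
    exchanged : lookup (map gen bs [ j ]≔ ⟦ g ⟧ᶜ) j ∷ ((map gen bs [ j ]≔ ⟦ g ⟧ᶜ) [ j ]≔ gen x)
              ≡ ⟦ g ⟧ᶜ ∷ map gen (bs [ j ]≔ x)
    exchanged = cong₂ _∷_ (lookup∘update j (map gen bs) ⟦ g ⟧ᶜ)
                          (≡.trans ([]≔-idempotent (map gen bs) j) (≡.sym (map-[]≔ gen bs j)))
  bracket-of-two-combs {p = p} rec (_◂_ {a} h cs) g refl bs j =
    jacobi-step rec h cs (letters-with-comb-Combs bs j g)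
      (λ f → bracket-of-two-combs rec h f (+-suc a p) cs)

  bracket-of-bracketed-head : ∀ {a K} {zs : Vec Tm m} →
    WfRec _<_ BracketOfCombsSpanned (suc a + K) → (e : Comb a) (bs : Vec X m) → Combs K zs →
    CombSpan (suc (suc a + K)) (br (⟦ e ◂ bs ⟧ᶜ ∷ zs))
  bracket-of-bracketed-head {a} {K} rec e bs cs =
    jacobi-step rec e bs cs (λ f → bracket-of-two-combs rec e f (+-suc a K) bs)

  bracket-of-combs : ∀ {K} → BracketOfCombsSpanned K
  bracket-of-combs {K} = <-rec BracketOfCombsSpanned step K
    where
    step : ∀ K → WfRec _<_ BracketOfCombsSpanned K → BracketOfCombsSpanned K
    step _ rec ((e ◂ bs) ∷ cs) = bracket-of-bracketed-head rec e bs cs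
    step _ rec (_∷_ {ts = zs} (letter x) cs) with lettersOrBracket x cs
    ... | letters xs = span-gen (letter x ◂ xs)
    ... | bracketed j e bs zⱼ≡e◂bs cs′ =
      Span-swap-head (gen x) zs j
        (subst (λ z → CombSpan _ (br (z ∷ (zs [ j ]≔ gen x)))) (≡.sym zⱼ≡e◂bs)
          (bracket-of-bracketed-head rec e bs cs′))

  mutual
    word-CombSpan : (w : Word) → CombSpan (brackets w) ⟦ w ⟧
    word-CombSpan (leaf x)  = span-gen (letter x)
    word-CombSpan (node ws) = multilinear-CombSpan br br-multilinear ws bracket-of-combs

    multilinear-CombSpan : ∀ {l K} (f : Vec Tm l → Tm) → Multilinear f → (ws : Vec Word l) →
      (∀ {ts} → Combs (bracketsV ws) ts → CombSpan K (f ts)) → CombSpan K (f ⟦ ws ⟧V)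
    multilinear-CombSpan f f-lin []       f-combs = f-combs []
    multilinear-CombSpan f f-lin (w ∷ ws) f-combs =
      Span-map (f-lin (⟦ w ⟧ ∷ ⟦ ws ⟧V) zero)
        (λ c → multilinear-CombSpan (λ ts → f (⟦ c ⟧ᶜ ∷ ts)) (λ v i → f-lin (⟦ c ⟧ᶜ ∷ v) (suc i))
                 ws (λ cs → f-combs (c ∷ cs)))
        (word-CombSpan w)

  linComb : List (F.Carrier × Word) → Tm
  linComb = List.foldr (λ aw s → proj₁ aw ·t ⟦ proj₂ aw ⟧ +t s) 0t

  linComb-++ : ∀ xs ys → linComb (xs ++ ys) ≈t linComb xs +t linComb ys
  linComb-++ []       ys = symt (t+-idˡ _)
  linComb-++ (x ∷ xs) ys = transt (t+-cong reflt (linComb-++ xs ys)) (symt (t+-assoc _ _ _))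

  scaleBy : F.Carrier → F.Carrier × Word → F.Carrier × Word
  scaleBy a (b , w) = a * b , w

  linComb-scale : ∀ a xs → a ·t linComb xs ≈t linComb (List.map (scaleBy a) xs)
  linComb-scale a []             = a·0≈0 a
  linComb-scale a ((b , w) ∷ xs) =
    transt (t·-distribˡ a _ _) (t+-cong (symt (t·-assoc a b _)) (linComb-scale a xs))

  module _ {p} {P : Word → Set p} where

    InSpan-gen : ∀ {w} → P w → InSpan P ⟦ w ⟧
    InSpan-gen {w} pw =
      (1# , w) ∷ [] , pw ∷ [] , symt (transt (t+-comm _ _) (transt (t+-idˡ _) (t·-idˡ _)))

    InSpan-+ : ∀ {s t} → InSpan P s → InSpan P t → InSpan P (s +t t)
    InSpan-+ (xs , P-xs , s≈) (ys , P-ys , t≈) =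
      xs ++ ys , ++⁺ P-xs P-ys , transt (t+-cong s≈ t≈) (symt (linComb-++ xs ys))

    InSpan-· : ∀ {t} a → InSpan P t → InSpan P (a ·t t)
    InSpan-· a (xs , P-xs , t≈) =
      List.map (scaleBy a) xs , map⁺ P-xs , transt (t·-cong F.refl t≈) (linComb-scale a xs)

    Span⇒InSpan : ∀ {I : Set c} {f : I → Tm} {t} →
      (∀ i → InSpan P (f i)) → Span f t → InSpan P t
    Span⇒InSpan f∈ (span-gen i) = f∈ i
    Span⇒InSpan f∈ span-0       = [] , [] , reflt
    Span⇒InSpan f∈ (span-+ p q) = InSpan-+ (Span⇒InSpan f∈ p) (Span⇒InSpan f∈ q)
    Span⇒InSpan f∈ (span-· a q) = InSpan-· a (Span⇒InSpan f∈ q)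
    Span⇒InSpan f∈ (span-≈ e q) with Span⇒InSpan f∈ q
    ... | xs , P-xs , t≈ = xs , P-xs , transt e t≈

    InSpan⇒Span : ∀ {I : Set c} {f : I → Tm} {t} →
      (∀ {w} → P w → Span f ⟦ w ⟧) → InSpan P t → Span f t
    InSpan⇒Span {f = f} P⊆ (xs , P-xs , t≈) = span-≈ t≈ (linComb-Span xs P-xs)
      where
      linComb-Span : ∀ xs → All (λ aw → P (proj₂ aw)) xs → Span f (linComb xs)
      linComb-Span []             []           = span-0
      linComb-Span ((a , w) ∷ xs) (pw ∷ P-xs) =
        span-+ (span-· a (P⊆ pw)) (linComb-Span xs P-xs)

  toWord : ∀ {k} → Comb k → Word
  toWord (letter x) = leaf x
  toWord (c ◂ as)   = node (toWord c ∷ map leaf as)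

  toWord-IsComb : ∀ {k} (c : Comb k) → IsComb (toWord c)
  toWord-IsComb (letter x) = comb-leaf x
  toWord-IsComb (c ◂ as)   = comb-node as (toWord-IsComb c)

  bracketsV-leaves : ∀ {l} (as : Vec X l) → bracketsV (map leaf as) ≡ 0
  bracketsV-leaves []       = refl
  bracketsV-leaves (a ∷ as) = bracketsV-leaves as

  brackets-toWord : ∀ {k} (c : Comb k) → brackets (toWord c) ≡ k
  brackets-toWord (letter x)     = refl
  brackets-toWord (_◂_ {k} c as) =
    cong suc (≡.trans (cong₂ _+_ (brackets-toWord c) (bracketsV-leaves as)) (+-identityʳ k))

  ⟦leaves⟧V : ∀ {l} (as : Vec X l) → ⟦ map leaf as ⟧V ≡ map gen as
  ⟦leaves⟧V []       = refl
  ⟦leaves⟧V (a ∷ as) = cong (gen a ∷_) (⟦leaves⟧V as)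

  ⟦toWord⟧ : ∀ {k} (c : Comb k) → ⟦ toWord c ⟧ ≡ ⟦ c ⟧ᶜ
  ⟦toWord⟧ (letter x) = refl
  ⟦toWord⟧ (c ◂ as)   = cong br (cong₂ _∷_ (⟦toWord⟧ c) (⟦leaves⟧V as))

  comb-InCombSpan : ∀ {k} (c : Comb k) → InCombSpan k ⟦ c ⟧ᶜ
  comb-InCombSpan c =
    subst (InCombSpan _) (⟦toWord⟧ c) (InSpan-gen (toWord-IsComb c , brackets-toWord c))

open CombSpanning using (Span⇒InSpan; InSpan⇒Span; comb-InCombSpan; word-CombSpan)
open FreeFilippov using (Tm; InLie; InCombSpan)

proposition3p1 : ∀ {c ℓ : Level} (F : Field c ℓ) (X : Set c) (m : ℕ) → 1 ≤ m →
    (k : ℕ) (t : Tm F X m) → InLie F X m k t → InCombSpan F X m k t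
proposition3p1 F X m _ k t t∈Lie =
  Span⇒InSpan F X m (comb-InCombSpan F X m)
    (InSpan⇒Span F X m (λ { {w} refl → word-CombSpan F X m w }) t∈Lie)
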